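{- Fix an integer $k\ge1$. There is a data structure (the limited semi-dynamic minimizer data structure, storing in a deque the (position, value) pairs of length-$k$ fragments of $X$ not dominated by any other such pair) that maintains a string $X$ under the operations Prepend($a$), Append($a$) and DeleteFirst(), supports minimizer queries in $\mathcal{O}(1)$ time, and performs each of these operations in $\mathcal{O}(1)$ amortized time.
   Context: Let $\Sigma$ be an alphabet and $\rho=(\Sigma^k,\le)$ a total order on $\Sigma^k$ defined via Karp–Rabin fingerprints (values): comparing two length-$k$ strings takes $\mathcal{O}(1)$ time, and the value of a length-$k$ fragment created or removed by an update can be computed in $\mathcal{O}(1)$ time from the stored value of the neighbouring length-$k$ fragment. The minimizer of $X$ is the smallest position at which a smallest (w.r.t. $\rho$) length-$k$ substring of $X$ starts; a minimizer query returns it (and its value). Positions are measured relative to the initial start of the string. Operations: Prepend($a$): $X\mapsto aX$; Append($a$): $X\mapsto Xa$; DeleteFirst(): $aX'\mapsto X'$. A pair $(p,v)$ is dominated by $(p',v')$ if $p'>p$ and $v'<v$. -}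

module Defs where

open import Level using (Level)
open import Data.Nat using (ℕ; zero; suc; _+_; _*_; _∸_; _≤_; _<_; _<ᵇ_)
open import Data.Integer as ℤ using (ℤ)
open import Data.List using (List; []; _∷_; _++_; [_]; length; take; drop; reverse)
open import Data.Bool using (true; false)
open import Data.Maybe using (Maybe; just; nothing)
open import Data.Product using (_×_; _,_; proj₁; proj₂)
open import Relation.Nullary using (¬_; yes; no)
open import Relation.Binary.PropositionalEquality using (_≡_)
open import Relation.Binary.Bundles using (DecTotalOrder)

-- Model of the data structure of the paper, with an explicit unit-cost model.
-- Σ is the alphabet, the order ρ on Σ^k is given by a value function
-- val : List Σ → Carrier O into a decidable total order (val is only ever applied
-- to length-k lists; it plays the role of the Karp–Rabin fingerprint).

data Op (Σ : Set) : Set where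
  Prepend     : Σ → Op Σ
  Append      : Σ → Op Σ
  DeleteFirst : Op Σ

module MinimizerDS {c ℓ₁ ℓ₂ : Level} (Σ : Set) (O : DecTotalOrder c ℓ₁ ℓ₂)
                   (val : List Σ → DecTotalOrder.Carrier O) (k : ℕ) where

  open DecTotalOrder O renaming (Carrier to V; _≤_ to _≼_; _≤?_ to _≼?_)

  -- A string X together with the (absolute) position of its first character,
  -- measured relative to the initial start of the string.
  record Str : Set where
    constructor mkStr
    field
      start : ℤ
      chars : List Σ
  open Str public

  frag : List Σ → ℕ → List Σ
  frag X i = take k (drop i X)

  record IsMinimizer (X : Str) (p : ℤ) (v : V) : Set (c Level.⊔ ℓ₁ Level.⊔ ℓ₂) where
    field
      offset     : ℕ
      pos≡       : p ≡ start X ℤ.+ ℤ.+ offset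
      inRange    : offset + k ≤ length (chars X)
      val≡       : val (frag (chars X) offset) ≈ v
      smallest   : ∀ j → j + k ≤ length (chars X) → v ≼ val (frag (chars X) j)
      leftmost   : ∀ j → j < offset → ¬ (val (frag (chars X) j) ≼ v)

  -- Deque of (position , value) pairs, listed front to back.
  Deque : Set c
  Deque = List (ℤ × V)

  record State : Set c where
    constructor mkState
    field
      string : Str
      deque  : Deque
  open State public

  initial : State
  initial = mkState (mkStr (ℤ.+ 0) []) []

  -- Append step: pop from the back all pairs whose value is strictly larger
  -- than v (they become dominated), counting one unit per pop.
  -- Works on the deque listed back to front.
  popBack : V → List (ℤ × V) → List (ℤ × V) × ℕ
  popBack v []             = [] , 0
  popBack v ((q , w) ∷ ds) with w ≼? v
  ... | yes _ = (q , w) ∷ ds , 0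
  ... | no  _ = let r = popBack v ds in proj₁ r , suc (proj₂ r)

  -- One update: new state and its cost (number of unit-cost steps:
  -- O(1) for computing the new fingerprint / a comparison, plus one per pop).
  step : State → Op Σ → State × ℕ
  step (mkState (mkStr s X) d) (Append a) with length (X ++ [ a ]) <ᵇ k
  ... | true  = mkState (mkStr s (X ++ [ a ])) d , 1
  ... | false =
    let X' = X ++ [ a ]
        i  = length X' ∸ k
        v  = val (frag X' i)
        r  = popBack v (reverse d)
    in mkState (mkStr s X') (reverse ((s ℤ.+ ℤ.+ i , v) ∷ proj₁ r)) , 2 + proj₂ r
  step (mkState (mkStr s X) d) (Prepend a) with length (a ∷ X) <ᵇ k
  ... | true  = mkState (mkStr (s ℤ.- ℤ.+ 1) (a ∷ X)) d , 1
  ... | false with d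
  ...   | [] = mkState (mkStr (s ℤ.- ℤ.+ 1) (a ∷ X))
                       [ (s ℤ.- ℤ.+ 1 , val (frag (a ∷ X) 0)) ] , 2
  ...   | (q , w) ∷ d' with val (frag (a ∷ X) 0) ≼? w
  ...     | yes _ = mkState (mkStr (s ℤ.- ℤ.+ 1) (a ∷ X))
                            ((s ℤ.- ℤ.+ 1 , val (frag (a ∷ X) 0)) ∷ (q , w) ∷ d') , 2
  ...     | no  _ = mkState (mkStr (s ℤ.- ℤ.+ 1) (a ∷ X)) ((q , w) ∷ d') , 2
  -- DeleteFirst on the empty string is a no-op (the operation requires X nonempty).
  step (mkState (mkStr s []) d) DeleteFirst = mkState (mkStr s []) d , 1
  step (mkState (mkStr s (a ∷ X)) []) DeleteFirst = mkState (mkStr (s ℤ.+ ℤ.+ 1) X) [] , 1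
  step (mkState (mkStr s (a ∷ X)) ((q , w) ∷ d')) DeleteFirst with q ℤ.≟ s
  ... | yes _ = mkState (mkStr (s ℤ.+ ℤ.+ 1) X) d' , 2
  ... | no  _ = mkState (mkStr (s ℤ.+ ℤ.+ 1) X) ((q , w) ∷ d') , 2

  run : State → List (Op Σ) → State × ℕ
  run st []         = st , 0
  run st (o ∷ os)   =
    let r₁ = step st o
        r₂ = run (proj₁ r₁) os
    in proj₁ r₂ , proj₂ r₁ + proj₂ r₂

  query : State → Maybe (ℤ × V)
  query st with deque st
  ... | []      = nothing
  ... | x ∷ _   = just x

  queryCost : State → ℕ
  queryCost _ = 1

-- The deque holds (position, value) pairs of fragments, sorted by position and by value,
-- and every length-k fragment is either stored or dominated by a later, strictly smaller
-- one. Following dominations always ends in the deque, so its front is the minimizer.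
-- Each update restores this with O(1) work plus one unit per pair it pops, and a pair is
-- pushed once and popped at most once, so with the deque length as potential every
-- update costs at most 3 amortized units.
module Submission where

open import Defs
open import Level using (Level; 0ℓ; _⊔_)
open import Function using (_∘_)
open import Data.Nat as ℕ using (ℕ; zero; suc; _+_; _*_; _∸_; _≤_; _<_; _<ᵇ_; z≤n; s≤s)
import Data.Nat.Properties as ℕP
import Data.Nat.Tactic.RingSolver as ℕSolver
open import Data.Integer as ℤ using (ℤ)
import Data.Integer.Properties as ℤP
import Data.Integer.Tactic.RingSolver as ℤSolver
open import Algebra.Bundles using (AbelianGroup)
import Algebra.Properties.Group as GroupProperties
open import Data.List using (List; []; _∷_; _++_; [_]; length; take; reverse)
import Data.List.Properties as ListP
open import Data.List.Relation.Unary.All as All using (All; []; _∷_)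
import Data.List.Relation.Unary.All.Properties as AllP
open import Data.List.Relation.Unary.Any as Any using (Any; here; there)
import Data.List.Relation.Unary.Any.Properties as AnyP
open import Data.List.Relation.Unary.AllPairs as AllPairs using (AllPairs; []; _∷_)
import Data.List.Relation.Unary.AllPairs.Properties as AllPairsP
open import Data.Bool using (true; false)
open import Data.Unit.Polymorphic using (⊤)
open import Data.Empty using (⊥-elim)
open import Data.Maybe using (just; nothing)
open import Data.Product using (Σ; _×_; _,_; proj₁; proj₂; uncurry)
open import Data.Sum as Sum using (_⊎_; inj₁; inj₂)
open import Relation.Nullary using (¬_; yes; no)
open import Relation.Nullary.Reflects using (ofʸ; ofⁿ)
open import Relation.Binary.PropositionalEquality
  using (_≡_; _≢_; refl; sym; trans; cong; subst; subst₂; module ≡-Reasoning)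
open import Relation.Binary.Bundles using (DecTotalOrder)
import Relation.Binary.Properties.DecTotalOrder as DecTotalOrderProperties

take-++-≤ : ∀ {a} {A : Set a} m (xs ys : List A) → m ≤ length xs →
            take m (xs ++ ys) ≡ take m xs
take-++-≤ zero    xs       ys _         = refl
take-++-≤ (suc m) (x ∷ xs) ys (s≤s m≤n) = cong (x ∷_) (take-++-≤ m xs ys m≤n)

length-snoc : ∀ {a} {A : Set a} (xs : List A) x → length (xs ++ [ x ]) ≡ suc (length xs)
length-snoc xs x = trans (ListP.length-++ xs) (ℕP.+-comm (length xs) 1)

All-reverse⁺ : ∀ {a p} {A : Set a} {P : A → Set p} {xs} → All P xs → All P (reverse xs)
All-reverse⁺ pxs = All.tabulate (All.lookup pxs ∘ AnyP.reverse⁻)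

AllPairs-++⁻ : ∀ {a r} {A : Set a} {R : A → A → Set r} xs {ys} → AllPairs R (xs ++ ys) →
               AllPairs R xs × AllPairs R ys × All (λ x → All (R x) ys) xs
AllPairs-++⁻ []       rs         = [] , rs , []
AllPairs-++⁻ (x ∷ xs) (rx ∷ rxs) with AllPairs-++⁻ xs rxs | AllP.++⁻ xs rx
... | rxs₁ , rxs₂ , cross | rx₁ , rx₂ = rx₁ ∷ rxs₁ , rxs₂ , rx₂ ∷ cross

module _ (s : ℤ) where
  open GroupProperties (AbelianGroup.group ℤP.+-0-abelianGroup) using (∙-cancelˡ)

  offset-injective : ∀ {i j} → s ℤ.+ ℤ.+ i ≡ s ℤ.+ ℤ.+ j → i ≡ j
  offset-injective eq = ℤP.+-injective (∙-cancelˡ s _ _ eq)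

  offset-mono-< : ∀ {i j} → i < j → s ℤ.+ ℤ.+ i ℤ.< s ℤ.+ ℤ.+ j
  offset-mono-< i<j = ℤP.+-monoʳ-< s (ℤ.+<+ i<j)

  offset-cancel-< : ∀ {i j} → s ℤ.+ ℤ.+ i ℤ.< s ℤ.+ ℤ.+ j → i < j
  offset-cancel-< lt = ℕP.≰⇒> (λ j≤i → ℤP.<⇒≱ lt (ℤP.+-monoʳ-≤ s (ℤ.+≤+ j≤i)))

offset-shift : ∀ {t} u → t ≡ u ℤ.+ ℤ.+ 1 → ∀ j → t ℤ.+ ℤ.+ j ≡ u ℤ.+ ℤ.+ suc j
offset-shift u refl j =
  trans (ℤP.+-assoc u (ℤ.+ 1) (ℤ.+ j)) (cong (λ z → u ℤ.+ z) (sym (ℤP.pos-+ 1 j)))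

module Correctness {c ℓ₁ ℓ₂ : Level} (A : Set) (O : DecTotalOrder c ℓ₁ ℓ₂)
                   (val : List A → DecTotalOrder.Carrier O) (k : ℕ) where
  open MinimizerDS A O val k
  open DecTotalOrder O using (module Eq)
    renaming (Carrier to V; _≤_ to _≼_; _≤?_ to _≼?_; refl to ≼-refl; trans to ≼-trans)
  open DecTotalOrderProperties O using () renaming (≰⇒≥ to ⋠⇒≽)

  ≡⇒≼ : ∀ {x y} → x ≡ y → x ≼ y
  ≡⇒≼ refl = ≼-refl

  fragVal : List A → ℕ → V
  fragVal X j = val (frag X j)

  fragVal-++ : ∀ X ys {j} → j + k ≤ length X → fragVal (X ++ ys) j ≡ fragVal X j
  fragVal-++ X       ys {zero}  k≤n       = cong val (take-++-≤ k X ys k≤n)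
  fragVal-++ (x ∷ X) ys {suc j} (s≤s j-in) = fragVal-++ X ys j-in

  fragment⇒k≤length : ∀ {n} j → j + k ≤ n → k ≤ n
  fragment⇒k≤length j = ℕP.≤-trans (ℕP.m≤n+m k j)

  record At (s : ℤ) (j : ℕ) (e : ℤ × V) : Set where
    constructor at
    field position : proj₁ e ≡ s ℤ.+ ℤ.+ j

  record StoredPair (s : ℤ) (X : List A) (e : ℤ × V) : Set c where
    constructor storedPair
    field
      offset  : ℕ
      placed  : At s offset e
      inRange : offset + k ≤ length X
      value   : proj₂ e ≡ fragVal X offset

  _⊏_ : ℤ × V → ℤ × V → Set ℓ₂
  (p , v) ⊏ (q , w) = p ℤ.< q × v ≼ w

  Dominated : List A → ℕ → Set ℓ₂
  Dominated X j = Σ ℕ λ j' → j < j' × j' + k ≤ length X × ¬ (fragVal X j ≼ fragVal X j')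

  Complete : ℤ → List A → Deque → Set (c ⊔ ℓ₂)
  Complete s X d = ∀ j → j + k ≤ length X → Any (At s j) d ⊎ Dominated X j

  CompleteBeyondFirst : ℤ → List A → Deque → Set (c ⊔ ℓ₂)
  CompleteBeyondFirst s X d =
    ∀ j → suc j + k ≤ length X → Any (At s (suc j)) d ⊎ Dominated X (suc j)

  -- Weaker than the paper's "exactly the undominated pairs", but enough for queries and
  -- preserved by every update.
  record Valid (s : ℤ) (X : List A) (d : Deque) : Set (c ⊔ ℓ₂) where
    constructor valid
    field
      stored   : All (StoredPair s X) d
      sorted   : AllPairs _⊏_ d
      complete : Complete s X d

  ValidState : State → Set (c ⊔ ℓ₂)
  ValidState st = Valid (start (string st)) (chars (string st)) (deque st)

  stored-value : ∀ {s X e j} → StoredPair s X e → At s j e → proj₂ e ≡ fragVal X j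
  stored-value {s} {X} (storedPair i (at pᵢ≡) _ w≡) (at pⱼ≡) =
    trans w≡ (cong (fragVal X) (offset-injective s (trans (sym pᵢ≡) pⱼ≡)))

  behind-stored⇒≢start : ∀ {s X f e} → StoredPair s X f → f ⊏ e → proj₁ e ≢ s
  behind-stored⇒≢start {s} (storedPair j (at p≡) _ _) (f<e , _) e≡s =
    ℤP.<⇒≢ (ℤP.≤-<-trans (subst (s ℤ.≤_) (sym p≡) (ℤP.i≤i+j s (ℤ.+ j))) f<e) (sym e≡s)

  short⇒no-stored : ∀ {s X d} → length X < k → Valid s X d → d ≡ []
  short⇒no-stored n<k (valid []                       _ _) = refl
  short⇒no-stored n<k (valid (storedPair j _ j-in _ ∷ _) _ _) =
    ⊥-elim (ℕP.<⇒≱ n<k (fragment⇒k≤length j j-in))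

  short⇒valid : ∀ {s X} → length X < k → Valid s X []
  short⇒valid n<k = valid [] [] λ j j-in → ⊥-elim (ℕP.<⇒≱ n<k (fragment⇒k≤length j j-in))

  stored-below : ∀ {s X d} → Complete s X d → ∀ j → j + k ≤ length X →
                 Σ ℕ λ i → Any (At s i) d × fragVal X i ≼ fragVal X j
  stored-below {s} {X} {d} complete j = descend (length X) j (ℕP.m≤n+m (length X) j)
    where
    -- dominating fragments move strictly right, so the chain stops within length X steps
    descend : ∀ fuel j → length X ≤ j + fuel → j + k ≤ length X →
              Σ ℕ λ i → Any (At s i) d × fragVal X i ≼ fragVal X j
    descend fuel j bound j-in with complete j j-in
    ... | inj₁ pos = j , pos , ≼-refl
    descend zero j bound j-in | inj₂ (j' , j<j' , j'-in , _) = ⊥-elim (ℕP.<⇒≱ j<j' (begin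
      j'        ≤⟨ ℕP.m≤m+n j' k ⟩
      j' + k    ≤⟨ j'-in ⟩
      length X  ≤⟨ bound ⟩
      j + 0     ≡⟨ ℕP.+-identityʳ j ⟩
      j         ∎))
      where open ℕP.≤-Reasoning
    descend (suc fuel) j bound j-in | inj₂ (j' , j<j' , j'-in , j⋠j')
      with descend fuel j' bound' j'-in
      where
      bound' : length X ≤ j' + fuel
      bound' = ℕP.≤-trans bound
                 (ℕP.≤-trans (ℕP.≤-reflexive (ℕP.+-suc j fuel)) (ℕP.+-monoˡ-≤ fuel j<j'))
    ... | i , pos , i≼j' = i , pos , ≼-trans i≼j' (⋠⇒≽ j⋠j')

  front-≼ : ∀ {s X e d j} → All (StoredPair s X) (e ∷ d) → AllPairs _⊏_ (e ∷ d) →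
            Any (At s j) (e ∷ d) → proj₂ e ≼ fragVal X j
  front-≼ (se ∷ _) _         (here pos)  = ≡⇒≼ (stored-value se pos)
  front-≼ (_ ∷ sd) (e⊏d ∷ _) (there pos) with All.lookupAny (All.zip (sd , e⊏d)) pos
  ... | (se' , _ , e≼e') , pos' = ≼-trans e≼e' (≡⇒≼ (stored-value se' pos'))

  front-isMinimizer : ∀ {s X p w d} → Valid s X ((p , w) ∷ d) → IsMinimizer (mkStr s X) p w
  front-isMinimizer {s} {X} {p} {w}
    (valid stored@(storedPair h (at p≡) h-in w≡ ∷ _) sorted complete) = record
    { offset = h ; pos≡ = p≡ ; inRange = h-in ; val≡ = Eq.reflexive (sym w≡)
    ; smallest = smallest ; leftmost = leftmost }
    where
    smallest : ∀ j → j + k ≤ length X → w ≼ fragVal X j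
    smallest j j-in with stored-below complete j j-in
    ... | _ , pos , i≼j = ≼-trans (front-≼ stored sorted pos) i≼j

    leftmost : ∀ j → j < h → ¬ (fragVal X j ≼ w)
    leftmost j j<h j≼w with complete j (ℕP.≤-trans (ℕP.+-monoˡ-≤ k (ℕP.<⇒≤ j<h)) h-in)
    ... | inj₁ (here (at p≡')) = ℕP.<-irrefl (offset-injective s (trans (sym p≡') p≡)) j<h
    ... | inj₁ (there pos) with All.lookupAny (AllPairs.head sorted) pos
    ...   | (p<q , _) , at q≡ = ℕP.<-asym j<h (offset-cancel-< s (subst₂ ℤ._<_ p≡ q≡ p<q))
    leftmost j j<h j≼w | inj₂ (j' , _ , j'-in , j⋠j') = j⋠j' (≼-trans j≼w (smallest j' j'-in))

  query-correct : ∀ st → ValidState st →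
    (length (chars (string st)) < k → query st ≡ nothing) ×
    (k ≤ length (chars (string st)) →
       Σ ℤ λ p → Σ V λ v → query st ≡ just (p , v) × IsMinimizer (string st) p v)
  query-correct (mkState (mkStr s X) []) (valid _ _ complete) = (λ _ → refl) , nonempty
    where
    nonempty : k ≤ length X → _
    nonempty k≤n with stored-below complete 0 k≤n
    ... | _ , () , _
  query-correct (mkState (mkStr s X) ((p , w) ∷ _)) v@(valid (storedPair h _ h-in _ ∷ _) _ _) =
    (λ n<k → ⊥-elim (ℕP.<⇒≱ n<k (fragment⇒k≤length h h-in))) ,
    (λ _ → p , w , refl , front-isMinimizer v)

  stored-++ : ∀ {s X ys e} → StoredPair s X e → StoredPair s (X ++ ys) e
  stored-++ {X = X} {ys} (storedPair j pos j-in w≡) =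
    storedPair j pos (ℕP.≤-trans j-in (ListP.length-++-≤ˡ X)) (trans w≡ (sym (fragVal-++ X ys j-in)))

  dominated-++ : ∀ {X ys j} → j + k ≤ length X → Dominated X j → Dominated (X ++ ys) j
  dominated-++ {X} {ys} j-in (j' , j<j' , j'-in , j⋠j') =
    j' , j<j' , ℕP.≤-trans j'-in (ListP.length-++-≤ˡ X) ,
    subst₂ (λ x y → ¬ (x ≼ y)) (sym (fragVal-++ X ys j-in)) (sym (fragVal-++ X ys j'-in)) j⋠j'

  dominated-∷ : ∀ {X a j} → Dominated X j → Dominated (a ∷ X) (suc j)
  dominated-∷ (j' , j<j' , j'-in , j⋠j') = suc j' , s≤s j<j' , s≤s j'-in , j⋠j'

  dominated-∷⁻ : ∀ {X a j} → Dominated (a ∷ X) (suc j) → Dominated X j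
  dominated-∷⁻ (suc j' , s≤s j<j' , s≤s j'-in , j⋠j') = j' , j<j' , j'-in , j⋠j'

  complete⇒beyondFirst : ∀ {s X d} → Complete s X d → CompleteBeyondFirst s X d
  complete⇒beyondFirst complete j = complete (suc j)

  beyondFirst-drop-front : ∀ {s X e d} → At s 0 e →
    CompleteBeyondFirst s X (e ∷ d) → CompleteBeyondFirst s X d
  beyondFirst-drop-front {s} (at p≡s+0) complete j j-in with complete j j-in
  ... | inj₁ (here (at p≡)) = ⊥-elim (ℕP.0≢1+n (offset-injective s (trans (sym p≡s+0) p≡)))
  ... | inj₁ (there pos)    = inj₁ pos
  ... | inj₂ dom            = inj₂ dom

  HeadAtMost : V → Deque → Set ℓ₂
  HeadAtMost v []      = ⊤
  HeadAtMost v (e ∷ _) = proj₂ e ≼ v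

  popBack-split : ∀ v rs → Σ Deque λ D → rs ≡ D ++ proj₁ (popBack v rs) ×
                  All (λ e → ¬ (proj₂ e ≼ v)) D × HeadAtMost v (proj₁ (popBack v rs))
  popBack-split v []             = [] , refl , [] , _
  popBack-split v ((q , w) ∷ rs) with w ≼? v
  ... | yes w≼v = [] , refl , [] , w≼v
  ... | no  w⋠v with popBack-split v rs
  ...   | D , rs≡ , D⋡v , head≼v = (q , w) ∷ D , cong ((q , w) ∷_) rs≡ , w⋠v ∷ D⋡v , head≼v

  popBack-cost : ∀ v rs → proj₂ (popBack v rs) + length (proj₁ (popBack v rs)) ≡ length rs
  popBack-cost v []             = refl
  popBack-cost v ((q , w) ∷ rs) with w ≼? v
  ... | yes _ = refl
  ... | no  _ = cong suc (popBack-cost v rs)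

  -- P lists the kept pairs back to front, so its head is the last pair of the sorted deque.
  sorted-below-head : ∀ v P → HeadAtMost v P → AllPairs _⊏_ (reverse P) →
                      All (λ e → proj₂ e ≼ v) (reverse P)
  sorted-below-head v []      _      _      = []
  sorted-below-head v (e ∷ P) e≼v sorted rewrite ListP.unfold-reverse e P
    with AllPairs-++⁻ (reverse P) sorted
  ... | _ , _ , cross = AllP.++⁺ (All.map (λ { ((_ , x≼e) ∷ []) → ≼-trans x≼e e≼v }) cross) (e≼v ∷ [])

  module Append (s : ℤ) (X : List A) (a : A) (k≤n' : k ≤ length (X ++ [ a ])) where
    i : ℕ
    i = length (X ++ [ a ]) ∸ k

    v : V
    v = fragVal (X ++ [ a ]) i

    new : ℤ × V
    new = s ℤ.+ ℤ.+ i , v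

    i+k≡n' : i + k ≡ length (X ++ [ a ])
    i+k≡n' = ℕP.m∸n+n≡m k≤n'

    old-before-new : ∀ {j} → j + k ≤ length X → j < i
    old-before-new {j} j-in = ℕP.+-cancelʳ-< k j i (begin-strict
      j + k                    ≤⟨ j-in ⟩
      length X                 <⟨ ℕP.n<1+n (length X) ⟩
      suc (length X)           ≡⟨ length-snoc X a ⟨
      length (X ++ [ a ])      ≡⟨ i+k≡n' ⟨
      i + k                    ∎)
      where open ℕP.≤-Reasoning

    valid-push-back : ∀ L E → Valid s X (L ++ E) → All (λ e → ¬ (proj₂ e ≼ v)) E →
                      All (λ e → proj₂ e ≼ v) L → Valid s (X ++ [ a ]) (L ++ [ new ])
    valid-push-back L E (valid stored sorted complete) E⋡v L≼v =
      valid stored' (AllPairsP.++⁺ (proj₁ (AllPairs-++⁻ L sorted)) ([] ∷ []) L⊏new) complete'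
      where
      stored' : All (StoredPair s (X ++ [ a ])) (L ++ [ new ])
      stored' = AllP.++⁺ (All.map stored-++ (AllP.++⁻ˡ L stored))
                         (storedPair i (at refl) (ℕP.≤-reflexive i+k≡n') refl ∷ [])

      old⊏new : ∀ {e} → StoredPair s X e → proj₂ e ≼ v → e ⊏ new
      old⊏new (storedPair j (at p≡) j-in _) e≼v =
        subst (ℤ._< proj₁ new) (sym p≡) (offset-mono-< s (old-before-new j-in)) , e≼v

      L⊏new : All (λ e → All (e ⊏_) [ new ]) L
      L⊏new = All.zipWith (λ (se , e≼v) → old⊏new se e≼v ∷ []) (AllP.++⁻ˡ L stored , L≼v)

      complete-old : ∀ j → j + k ≤ length X → Any (At s j) (L ++ [ new ]) ⊎ Dominated (X ++ [ a ]) j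
      complete-old j j-in with complete j j-in
      ... | inj₂ dom = inj₂ (dominated-++ j-in dom)
      ... | inj₁ pos with AnyP.++⁻ L pos
      ...   | inj₁ pos-L = inj₁ (AnyP.++⁺ˡ pos-L)
      ...   | inj₂ pos-E with All.lookupAny (All.zip (AllP.++⁻ʳ L stored , E⋡v)) pos-E
      ...     | (se , e⋡v) , pos' =
                inj₂ (i , old-before-new j-in , ℕP.≤-reflexive i+k≡n' ,
                      e⋡v ∘ subst (_≼ v) (trans (fragVal-++ X [ a ] j-in) (sym (stored-value se pos'))))

      complete' : Complete s (X ++ [ a ]) (L ++ [ new ])
      complete' j j-in with ℕP.m≤n⇒m<n∨m≡n j-in
      ... | inj₂ j+k≡n' =
            inj₁ (AnyP.++⁺ʳ L (here (at (cong (λ z → s ℤ.+ ℤ.+ z)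
                                        (ℕP.+-cancelʳ-≡ k i j (trans i+k≡n' (sym j+k≡n')))))))
      ... | inj₁ j+k<n' = complete-old j (ℕP.≤-pred (subst (j + k <_) (length-snoc X a) j+k<n'))

    valid-append : ∀ d → Valid s X d →
                   Valid s (X ++ [ a ]) (reverse (new ∷ proj₁ (popBack v (reverse d))))
    valid-append d vd with popBack-split v (reverse d)
    ... | D , rd≡ , D⋡v , head≼v =
          subst (Valid s (X ++ [ a ])) (sym (ListP.unfold-reverse new P))
            (valid-push-back (reverse P) (reverse D) vd' (All-reverse⁺ D⋡v)
              (sorted-below-head v P head≼v (proj₁ (AllPairs-++⁻ (reverse P) (Valid.sorted vd')))))
      where
      P = proj₁ (popBack v (reverse d))
      d≡ : d ≡ reverse P ++ reverse D
      d≡ = trans (sym (ListP.reverse-involutive d)) (trans (cong reverse rd≡) (ListP.reverse-++ D P))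
      vd' = subst (Valid s X) d≡ vd

  -- Prepend goes from (t, X) to (u, a ∷ X) and DeleteFirst goes back, so both use these lemmas.
  module Shift {t u : ℤ} (t≡u+1 : t ≡ u ℤ.+ ℤ.+ 1) (a : A) (X : List A) where
    at-shift : ∀ {j e} → At t j e → At u (suc j) e
    at-shift {j} (at p≡) = at (trans p≡ (offset-shift u t≡u+1 j))

    at-unshift : ∀ {j e} → At u (suc j) e → At t j e
    at-unshift {j} (at p≡) = at (trans p≡ (sym (offset-shift u t≡u+1 j)))

    stored-shift : ∀ {e} → StoredPair t X e → StoredPair u (a ∷ X) e
    stored-shift (storedPair j pos j-in w≡) = storedPair (suc j) (at-shift pos) (s≤s j-in) w≡

    stored-unshift : ∀ {e} → StoredPair u (a ∷ X) e → proj₁ e ≢ u → StoredPair t X e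
    stored-unshift (storedPair zero (at p≡) _ _) e≢u =
      ⊥-elim (e≢u (trans p≡ (ℤP.+-identityʳ u)))
    stored-unshift (storedPair (suc j) pos (s≤s j-in) w≡) _ =
      storedPair j (at-unshift pos) j-in w≡

    stored-shift-after-start : ∀ {e} → StoredPair t X e → u ℤ.< proj₁ e
    stored-shift-after-start (storedPair _ pos _ _) =
      subst₂ ℤ._<_ (ℤP.+-identityʳ u) (sym (At.position (at-shift pos))) (offset-mono-< u (s≤s z≤n))

    complete-shift : ∀ {d} → Complete t X d → CompleteBeyondFirst u (a ∷ X) d
    complete-shift complete j (s≤s j-in) = Sum.map (Any.map at-shift) dominated-∷ (complete j j-in)

    complete-unshift : ∀ {d} → CompleteBeyondFirst u (a ∷ X) d → Complete t X d
    complete-unshift complete j j-in = Sum.map (Any.map at-unshift) dominated-∷⁻ (complete j (s≤s j-in))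

    valid-push-front : ∀ {d} → k ≤ length (a ∷ X) → Valid t X d →
                       All (λ e → fragVal (a ∷ X) 0 ≼ proj₂ e) d →
                       Valid u (a ∷ X) ((u , fragVal (a ∷ X) 0) ∷ d)
    valid-push-front k≤n (valid stored sorted complete) v₀≼d =
      valid (storedPair 0 (at u≡u+0) k≤n refl ∷ All.map stored-shift stored)
            (All.zipWith (λ (se , v₀≼e) → stored-shift-after-start se , v₀≼e) (stored , v₀≼d) ∷ sorted)
            complete'
      where
      u≡u+0 : u ≡ u ℤ.+ ℤ.+ 0
      u≡u+0 = sym (ℤP.+-identityʳ u)
      complete' : Complete u (a ∷ X) _
      complete' zero    _    = inj₁ (here (at u≡u+0))
      complete' (suc j) j-in = Sum.map₁ there (complete-shift complete j j-in)

    valid-prepend-behind : ∀ {q w d} → Valid t X ((q , w) ∷ d) → ¬ (fragVal (a ∷ X) 0 ≼ w) →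
                           Valid u (a ∷ X) ((q , w) ∷ d)
    valid-prepend-behind (valid stored@(storedPair h _ h-in w≡ ∷ _) sorted complete) v₀⋠w =
      valid (All.map stored-shift stored) sorted complete'
      where
      complete' : Complete u (a ∷ X) _
      complete' zero    _    = inj₂ (suc h , s≤s z≤n , s≤s h-in , subst (λ x → ¬ (_ ≼ x)) w≡ v₀⋠w)
      complete' (suc j) j-in = complete-shift complete j j-in

    valid-unshift : ∀ {d} → All (StoredPair u (a ∷ X)) d → AllPairs _⊏_ d →
                    All (λ e → proj₁ e ≢ u) d → CompleteBeyondFirst u (a ∷ X) d → Valid t X d
    valid-unshift stored sorted d≢u complete =
      valid (All.zipWith (uncurry stored-unshift) (stored , d≢u)) sorted (complete-unshift complete)

  start-pred-suc : ∀ s → s ≡ (s ℤ.- ℤ.+ 1) ℤ.+ ℤ.+ 1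
  start-pred-suc = ℤSolver.solve-∀

  valid-deleteFirst-front : ∀ {s a X q w d} → Valid s (a ∷ X) ((q , w) ∷ d) → q ≡ s →
                            Valid (s ℤ.+ ℤ.+ 1) X d
  valid-deleteFirst-front {s} {a} {X} (valid (sf ∷ sd) (f⊏d ∷ sorted) complete) q≡s =
    Shift.valid-unshift refl a X sd sorted (All.map (behind-stored⇒≢start sf) f⊏d)
      (beyondFirst-drop-front (at (trans q≡s (sym (ℤP.+-identityʳ s))))
                              (complete⇒beyondFirst complete))

  valid-deleteFirst-keep : ∀ {s a X d} → Valid s (a ∷ X) d → All (λ e → proj₁ e ≢ s) d →
                           Valid (s ℤ.+ ℤ.+ 1) X d
  valid-deleteFirst-keep {a = a} {X} (valid stored sorted complete) d≢s =
    Shift.valid-unshift refl a X stored sorted d≢s (complete⇒beyondFirst complete)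

  step-valid : ∀ st o → ValidState st → ValidState (proj₁ (step st o))
  step-valid (mkState (mkStr s X) d) (Append a) vd
    with length (X ++ [ a ]) <ᵇ k | ℕP.<ᵇ-reflects-< (length (X ++ [ a ])) k
  ... | true  | ofʸ n'<k =
        subst (Valid s (X ++ [ a ]))
              (sym (short⇒no-stored (ℕP.≤-<-trans (ListP.length-++-≤ˡ X) n'<k) vd))
              (short⇒valid n'<k)
  ... | false | ofⁿ n'≮k = Append.valid-append s X a (ℕP.≮⇒≥ n'≮k) d vd
  step-valid (mkState (mkStr s X) d) (Prepend a) vd
    with length (a ∷ X) <ᵇ k | ℕP.<ᵇ-reflects-< (length (a ∷ X)) k
  ... | true  | ofʸ n'<k =
        subst (Valid (s ℤ.- ℤ.+ 1) (a ∷ X))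
              (sym (short⇒no-stored (ℕP.<-trans (ℕP.n<1+n (length X)) n'<k) vd))
              (short⇒valid n'<k)
  step-valid (mkState (mkStr s X) []) (Prepend a) vd | false | ofⁿ n'≮k =
    Shift.valid-push-front (start-pred-suc s) a X (ℕP.≮⇒≥ n'≮k) vd []
  step-valid (mkState (mkStr s X) ((q , w) ∷ d)) (Prepend a) vd | false | ofⁿ n'≮k
    with val (frag (a ∷ X) 0) ≼? w
  ... | yes v₀≼w = Shift.valid-push-front (start-pred-suc s) a X (ℕP.≮⇒≥ n'≮k) vd
                     (v₀≼w ∷ All.map (≼-trans v₀≼w ∘ proj₂) (AllPairs.head (Valid.sorted vd)))
  ... | no  v₀⋠w = Shift.valid-prepend-behind (start-pred-suc s) a X vd v₀⋠w
  step-valid (mkState (mkStr s [])      d)                DeleteFirst vd = vd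
  step-valid (mkState (mkStr s (a ∷ X)) [])               DeleteFirst vd = valid-deleteFirst-keep vd []
  step-valid (mkState (mkStr s (a ∷ X)) ((q , w) ∷ d)) DeleteFirst vd@(valid (sf ∷ _) (f⊏d ∷ _) _)
    with q ℤ.≟ s
  ... | yes q≡s = valid-deleteFirst-front vd q≡s
  ... | no  q≢s = valid-deleteFirst-keep vd (q≢s ∷ All.map (behind-stored⇒≢start sf) f⊏d)

  run-valid : ∀ st ops → ValidState st → ValidState (proj₁ (run st ops))
  run-valid st []       vst = vst
  run-valid st (o ∷ os) vst = run-valid (proj₁ (step st o)) os (step-valid st o vst)

  initial-valid : 1 ≤ k → ValidState initial
  initial-valid = short⇒valid

  step-cost : ∀ st o →
    proj₂ (step st o) + length (deque (proj₁ (step st o))) ≤ 3 + length (deque st)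
  step-cost (mkState (mkStr s X) d) (Append a) with length (X ++ [ a ]) <ᵇ k
  ... | true  = ℕP.+-monoˡ-≤ (length d) (s≤s z≤n)
  ... | false = ℕP.≤-reflexive (begin
      2 + pops + length (reverse (new ∷ kept)) ≡⟨ cong (2 + pops +_) (ListP.length-reverse (new ∷ kept)) ⟩
      2 + pops + suc (length kept)             ≡⟨ cong (2 +_) (ℕP.+-suc pops (length kept)) ⟩
      3 + (pops + length kept)                 ≡⟨ cong (3 +_) (popBack-cost v (reverse d)) ⟩
      3 + length (reverse d)                   ≡⟨ cong (3 +_) (ListP.length-reverse d) ⟩
      3 + length d                             ∎)
    where
    open ≡-Reasoning
    v = val (frag (X ++ [ a ]) (length (X ++ [ a ]) ∸ k))
    new = s ℤ.+ ℤ.+ (length (X ++ [ a ]) ∸ k) , v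
    kept = proj₁ (popBack v (reverse d))
    pops = proj₂ (popBack v (reverse d))
  step-cost (mkState (mkStr s X) d) (Prepend a) with length (a ∷ X) <ᵇ k
  ... | true = ℕP.+-monoˡ-≤ (length d) (s≤s z≤n)
  step-cost (mkState (mkStr s X) []) (Prepend a) | false = ℕP.≤-refl
  step-cost (mkState (mkStr s X) ((q , w) ∷ d)) (Prepend a) | false with val (frag (a ∷ X) 0) ≼? w
  ... | yes _ = ℕP.≤-refl
  ... | no  _ = ℕP.n≤1+n _
  step-cost (mkState (mkStr s [])      d)             DeleteFirst = ℕP.+-monoˡ-≤ (length d) (s≤s z≤n)
  step-cost (mkState (mkStr s (a ∷ X)) [])            DeleteFirst = s≤s z≤n
  step-cost (mkState (mkStr s (a ∷ X)) ((q , w) ∷ d)) DeleteFirst with q ℤ.≟ s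
  ... | yes _ = ℕP.m≤n+m _ 2
  ... | no  _ = ℕP.n≤1+n _

  run-cost : ∀ st ops →
    proj₂ (run st ops) + length (deque (proj₁ (run st ops))) ≤ 3 * length ops + length (deque st)
  run-cost st []       = ℕP.≤-refl
  run-cost st (o ∷ os) = begin
    (c₁ + c₂) + φ₂         ≡⟨ ℕP.+-assoc c₁ c₂ φ₂ ⟩
    c₁ + (c₂ + φ₂)         ≤⟨ ℕP.+-monoʳ-≤ c₁ (run-cost st₁ os) ⟩
    c₁ + (3 * n + φ₁)      ≡⟨ exchange c₁ (3 * n) φ₁ ⟩
    3 * n + (c₁ + φ₁)      ≤⟨ ℕP.+-monoʳ-≤ (3 * n) (step-cost st o) ⟩
    3 * n + (3 + φ₀)       ≡⟨ regroup n φ₀ ⟩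
    3 * suc n + φ₀         ∎
    where
    open ℕP.≤-Reasoning
    st₁ = proj₁ (step st o)
    c₁ = proj₂ (step st o)
    c₂ = proj₂ (run st₁ os)
    φ₀ = length (deque st)
    φ₁ = length (deque st₁)
    φ₂ = length (deque (proj₁ (run st₁ os)))
    n = length os
    exchange : ∀ x y z → x + (y + z) ≡ y + (x + z)
    exchange = ℕSolver.solve-∀
    regroup : ∀ n φ → 3 * n + (3 + φ) ≡ 3 * suc n + φ
    regroup = ℕSolver.solve-∀

  run-cost-initial : ∀ ops → proj₂ (run initial ops) ≤ 3 * length ops
  run-cost-initial ops =
    ℕP.≤-trans (ℕP.m≤m+n _ _)
               (ℕP.≤-trans (run-cost initial ops) (ℕP.≤-reflexive (ℕP.+-identityʳ _)))

lemma5 : Σ ℕ λ C →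
    (A : Set) (O : DecTotalOrder 0ℓ 0ℓ 0ℓ)
      (val : List A → DecTotalOrder.Carrier O) (k : ℕ) → 1 ≤ k →
    (ops : List (Op A)) →
    let open MinimizerDS A O val k
        st = proj₁ (run initial ops)
        X = string st
    in (proj₂ (run initial ops) ≤ C * length ops)
       × (queryCost st ≤ C)
       × (length (chars X) < k → query st ≡ nothing)
       × (k ≤ length (chars X) →
            Σ ℤ λ p → Σ (DecTotalOrder.Carrier O) λ v →
              (query st ≡ just (p , v)) × IsMinimizer X p v)
lemma5 = 3 , λ A O val k 1≤k ops →
  let open Correctness A O val k
  in run-cost-initial ops , s≤s z≤n , query-correct _ (run-valid _ ops (initial-valid 1≤k))
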